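{- In the setting described in the context, the bipartite graph $\widehat{H}$ satisfies the following. (1) If $\{b,A\}\in E(\widehat{H})$ with $b\in B_c$ and $A\in\mathcal{A}$, then $G$ has a chordless cycle consisting of the edges $\{v,b\}$ and $\{v,z(A)\}$ together with an edge from $b$ to a vertex of $A$ and a path in $A$ (so its vertex set is contained in $\{v,b\}\cup V(A)$). (2) If $\{b,A\},\{b,A'\}$ are two distinct edges of $\widehat{H}$ with $b\in B_f$ and $A,A'\in\mathcal{A}$, then $G$ has a chordless cycle consisting of the edges $\{v,z(A)\}$, $\{v,z(A')\}$, two edges incident to $b$, and paths in $A$ and in $A'$ (so its vertex set is contained in $\{v,b\}\cup V(A)\cup V(A')$).
   Context: Let $G$ be a finite simple undirected graph; a chordless cycle is an induced cycle on at least four vertices, and a graph is chordal if it has none. Let $E_I,E_M\subseteq E(G)$ and for $u\in V(G)$ let $N^R_G(u)=\{w\in N_G(u):\{u,w\}\notin E_I\cup E_M\}$. Fix $v\in V(G)$ and a set $B_v\subseteq V(G)\setminus\{v\}$ such that $G\setminus B_v$ is chordal. Let $I$ be an independent set of $G$ with $I\subseteq N^R_G(v)\setminus B_v$. Let $X=N_G(v)\setminus(B_v\cup I)$, let $H=G\setminus(\{v\}\cup B_v\cup X)$, and let $\mathcal{A}$ be the set of connected components of $H$ that contain at least one vertex of $I$. Each $A\in\mathcal{A}$ contains exactly one vertex of $I$, denoted $z(A)$. For a vertex set $U$, $N_G(U)=\bigcup_{u\in U}N_G(u)$. Let $B_c=B_v\cap N_G(v)$ and $B_f=B_v\setminus B_c$.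 The bipartite graph $\widehat{H}$ has vertex set $\mathcal{A}\cup B_v$ (each component $A$ is a single vertex); for $b\in B_c$ and $A\in\mathcal{A}$, $\{b,A\}\in E(\widehat{H})$ iff $b\in N_G(V(A))\setminus N_G(z(A))$; for $b\in B_f$ and $A\in\mathcal{A}$, $\{b,A\}\in E(\widehat{H})$ iff $b\in N_G(V(A))$. -}

module Defs where

open import Data.Nat using (ℕ; zero; suc; _≤_)
open import Data.Fin using (Fin; toℕ)
open import Data.Fin.Subset using (Subset; _∈_; _∉_)
open import Data.Bool using (Bool; true; false)
open import Data.List using (List; []; _∷_; length; lookup; head; last; _++_)
open import Data.List.Relation.Unary.All using (All)
open import Data.List.Relation.Unary.Unique.Propositional using (Unique)
open import Data.Maybe using (just)
open import Data.Product using (Σ; _×_; _,_; ∃; ∃-syntax)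
open import Data.Sum using (_⊎_)
open import Data.Empty using (⊥)
open import Relation.Nullary using (¬_)
open import Relation.Binary.PropositionalEquality using (_≡_; _≢_)
open import Function.Bundles using (_⇔_)

record Graph (n : ℕ) : Set where
  field
    adj    : Fin n → Fin n → Bool
    sym    : ∀ u w → adj u w ≡ adj w u
    irrefl : ∀ u → adj u u ≡ false

open Graph public

module _ {n : ℕ} (G : Graph n) where

  Adj : Fin n → Fin n → Set
  Adj u w = adj G u w ≡ true

  CycAdj : (k : ℕ) → Fin k → Fin k → Set
  CycAdj k i j =
      (suc (toℕ i) ≡ toℕ j) ⊎ (suc (toℕ j) ≡ toℕ i)
    ⊎ ((toℕ i ≡ 0 × suc (toℕ j) ≡ k) ⊎ (toℕ j ≡ 0 × suc (toℕ i) ≡ k))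

  -- The list c = (c₀, …, c_{k-1}) is (the cyclic vertex sequence of) a chordless
  -- cycle of G: at least four distinct vertices, and two of them are adjacent in G
  -- exactly when they are cyclically consecutive (edges of the cycle, no chords).
  ChordlessCycle : List (Fin n) → Set
  ChordlessCycle c =
      4 ≤ length c
    × Unique c
    × (∀ i j → Adj (lookup c i) (lookup c j) ⇔ CycAdj (length c) i j)

  -- G ∖ S is chordal (S a vertex set): no chordless cycle of G avoids S
  -- (chordless cycles of the induced subgraph G ∖ S are exactly those of G
  -- whose vertices all lie outside S).
  ChordalMinus : Subset n → Set
  ChordalMinus S = ∀ c → ChordlessCycle c → All (λ u → u ∉ S) c → ⊥

  data ConnIn (P : Fin n → Set) : Fin n → Fin n → Set where
    here : ∀ {x} → P x → ConnIn P x x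
    step : ∀ {x y w} → P x → Adj x y → ConnIn P y w → ConnIn P x w

  EdgeIn : (Fin n → Fin n → Set) → Fin n → Fin n → Set
  EdgeIn E u w = E u w ⊎ E w u

  EdgeSubset : (Fin n → Fin n → Set) → Set
  EdgeSubset E = ∀ u w → E u w → Adj u w

  InNR : (EI EM : Fin n → Fin n → Set) → Fin n → Fin n → Set
  InNR EI EM u w = Adj u w × ¬ EdgeIn EI u w × ¬ EdgeIn EM u w

  Independent : Subset n → Set
  Independent I = ∀ u w → u ∈ I → w ∈ I → ¬ Adj u w

  module Setting (v : Fin n) (B I : Subset n) where
    InX : Fin n → Set
    InX u = Adj v u × u ∉ B × u ∉ I

    InH : Fin n → Set
    InH u = u ≢ v × u ∉ B × ¬ InX u

    -- vertex set of the component of H containing z (for z ∈ I this is the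
    -- component A ∈ 𝒜 with z(A) = z)
    Comp : Fin n → Fin n → Set
    Comp z u = ConnIn InH z u

    NbrComp : Fin n → Fin n → Set
    NbrComp z b = ∃[ u ] (Comp z u × Adj b u)

    HatEdgeC : Fin n → Fin n → Set
    HatEdgeC b z = NbrComp z b × ¬ Adj z b

    HatEdgeF : Fin n → Fin n → Set
    HatEdgeF b z = NbrComp z b

module Submission where

-- A vertex of H adjacent to v lies in I, and a component A of H contains only one
-- such vertex, z(A): the first other one on an induced path leaving z(A) inside A
-- would close, through v, a chordless cycle avoiding B (or be a neighbour of z(A)
-- in I). So v sees A exactly at z(A). Shortcutting a walk inside A between z(A)
-- and a neighbour of b gives an induced path whose only vertex adjacent to b is
-- its end; closing it through b and v (and, for b ∉ N(v), through a second such
-- path in another component A′, which no vertex or edge of A meets) yields the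
-- required chordless cycle.

open import Defs hiding (sym)
open import Data.Nat using (ℕ; zero; suc; _≤_; z≤n; s≤s)
open import Data.Nat.Properties using (suc-injective; ≤-trans)
open import Data.Fin using (Fin; toℕ; zero; suc; _≟_)
open import Data.Fin.Subset using (Subset; _∈_; _∉_)
open import Data.Fin.Subset.Properties using (_∈?_)
open import Data.Bool using (true) renaming (_≟_ to _≟ᵇ_)
open import Data.List using (List; []; _∷_; length; lookup; head; last; _++_)
open import Data.List.Properties using (length-++-≤ʳ)
open import Data.List.Membership.Propositional.Properties using (∈-lookup)
open import Data.List.Relation.Unary.All as All using (All; []; _∷_)
open import Data.List.Relation.Unary.All.Properties using (¬Any⇒All¬; ++⁺)
open import Data.List.Relation.Unary.Any using (Any; here; there; any?)
open import Data.List.Relation.Unary.AllPairs as AllPairs using ([]; _∷_)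
open import Data.List.Relation.Unary.Unique.Propositional using (Unique)
open import Data.Maybe using (just)
open import Data.Maybe.Properties using (just-injective)
open import Data.Product using (_×_; _,_; proj₁; proj₂; ∃-syntax)
open import Data.Sum as Sum using (_⊎_; inj₁; inj₂)
open import Data.Empty using (⊥-elim)
open import Function using (_∘_; const)
open import Function.Bundles using (_⇔_; mk⇔)
import Function.Properties.Equivalence as ⇔
open import Relation.Nullary using (¬_; yes; no)
open import Relation.Nullary.Decidable using (_×-dec_; ¬?)
open import Relation.Unary using (Decidable)
open import Relation.Binary.PropositionalEquality
  using (_≡_; _≢_; refl; sym; trans; cong; ≢-sym)

private
  variable
    A : Set
    Q : A → Set
    x y t : A
    l r xs ys : List A

Consecutive : ℕ → ℕ → Set
Consecutive m n = suc m ≡ n ⊎ suc n ≡ m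

consecutive-suc : ∀ {m n} → Consecutive (suc m) (suc n) ⇔ Consecutive m n
consecutive-suc = mk⇔ (Sum.map suc-injective suc-injective) (Sum.map (cong suc) (cong suc))

data OnlyLast (Q : A → Set) : List A → Set where
  [_] : Q y → OnlyLast Q (y ∷ [])
  _∷_ : ¬ Q y → OnlyLast Q l → OnlyLast Q (y ∷ l)

onlyLast-lookup : OnlyLast Q l → ∀ j → Q (lookup l j) ⇔ suc (toℕ j) ≡ length l
onlyLast-lookup [ q ] zero = mk⇔ (const refl) (const q)
onlyLast-lookup (¬q ∷ [ _ ]) zero = mk⇔ (⊥-elim ∘ ¬q) λ ()
onlyLast-lookup (¬q ∷ _ ∷ _) zero = mk⇔ (⊥-elim ∘ ¬q) λ ()
onlyLast-lookup (_ ∷ ol) (suc j) =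
  ⇔.trans (onlyLast-lookup ol j) (mk⇔ (cong suc) suc-injective)

onlyHead-lookup : Q y → All (¬_ ∘ Q) r → ∀ j → Q (lookup (y ∷ r) j) ⇔ toℕ j ≡ 0
onlyHead-lookup q _ zero = mk⇔ (const refl) (const q)
onlyHead-lookup _ ¬qs (suc j) = mk⇔ (⊥-elim ∘ All.lookup ¬qs (∈-lookup j)) λ ()

endsOnly-lookup : Q x → OnlyLast Q r →
  ∀ j → Q (lookup (x ∷ r) j) ⇔ (toℕ j ≡ 0 ⊎ suc (toℕ j) ≡ length (x ∷ r))
endsOnly-lookup q _ zero = mk⇔ (const (inj₁ refl)) (const q)
endsOnly-lookup _ ol (suc j) = ⇔.trans (onlyLast-lookup ol j)
  (mk⇔ (inj₂ ∘ cong suc) λ { (inj₁ ()) ; (inj₂ e) → suc-injective e })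

onlyLast-++ : All (¬_ ∘ Q) xs → OnlyLast Q ys → OnlyLast Q (xs ++ ys)
onlyLast-++ [] ol = ol
onlyLast-++ (¬q ∷ ¬qs) ol = ¬q ∷ onlyLast-++ ¬qs ol

All-last : All Q l → last l ≡ just t → Q t
All-last (q ∷ []) refl = q
All-last (_ ∷ qs@(_ ∷ _)) e = All-last qs e

onlyLast-unique : Unique l → last l ≡ just t → Q t → All (λ e → Q e → e ≡ t) l →
  OnlyLast Q l
onlyLast-unique {l = _ ∷ []} _ refl q _ = [ q ]
onlyLast-unique {l = _ ∷ _ ∷ _} (y∉ ∷ u) lt q (f ∷ fs) =
  (λ qy → All-last y∉ lt (f qy)) ∷ onlyLast-unique u lt q fs

All-¬-elsewhere : All (x ≢_) l → All (λ e → Q e → e ≡ x) l → All (¬_ ∘ Q) l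
All-¬-elsewhere ≢s fs = All.zipWith (λ (x≢e , f) q → x≢e (sym (f q))) (≢s , fs)

module _ {n : ℕ} (G : Graph n) where

  private
    variable
      P : Fin n → Set
      u v w b : Fin n

  adj-sym : Adj G u w → Adj G w u
  adj-sym {u} {w} a = trans (Graph.sym G w u) a

  adj-comm : Adj G u w ⇔ Adj G w u
  adj-comm = mk⇔ adj-sym adj-sym

  adj-irrefl : ¬ Adj G u u
  adj-irrefl {u} a with trans (sym (Graph.irrefl G u)) a
  ... | ()

  adj? : ∀ u → Decidable (Adj G u)
  adj? u w = adj G u w ≟ᵇ true

  connIn-target : ConnIn G P u w → P w
  connIn-target (here p) = p
  connIn-target (step _ _ c) = connIn-target c

  connIn-map : {P′ : Fin n → Set} → (∀ {x} → P x → P′ x) →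
    ConnIn G P u w → ConnIn G P′ u w
  connIn-map f (here p) = here (f p)
  connIn-map f (step p a c) = step (f p) a (connIn-map f c)

  connIn-snoc : ConnIn G P u v → Adj G v w → P w → ConnIn G P u w
  connIn-snoc (here p) a q = step p a (here q)
  connIn-snoc (step p a′ c) a q = step p a′ (connIn-snoc c a q)

  connIn-trans : ConnIn G P u v → ConnIn G P v w → ConnIn G P u w
  connIn-trans (here _) c = c
  connIn-trans (step p a c₁) c₂ = step p a (connIn-trans c₁ c₂)

  connIn-sym : ConnIn G P u w → ConnIn G P w u
  connIn-sym (here p) = here p
  connIn-sym (step p a c) = connIn-snoc (connIn-sym c) (adj-sym a) p

  connIn-reach : ConnIn G P u w → ConnIn G (ConnIn G P u) u w
  connIn-reach (here p) = here (here p)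
  connIn-reach (step p a c) = step (here p) a (connIn-map (step p a) (connIn-reach c))

  truncateAtFirst : {Q : Fin n → Set} → Decidable Q → ConnIn G P u w → Q w →
    ∃[ y ] (Q y × ConnIn G (λ e → P e × (Q e → e ≡ y)) u y)
  truncateAtFirst Q? (here p) q = _ , q , here (p , const refl)
  truncateAtFirst {u = u} Q? (step p a c) q with Q? u
  ... | yes qu = u , qu , here (p , const refl)
  ... | no ¬qu with truncateAtFirst Q? c q
  ...   | y , qy , c′ = y , qy , step (p , ⊥-elim ∘ ¬qu) a c′

  data InducedPath : List (Fin n) → Set where
    [-]  : InducedPath (u ∷ [])
    cons : All (u ≢_) (w ∷ r) → Adj G u w → All (¬_ ∘ Adj G u) r →
           InducedPath (w ∷ r) → InducedPath (u ∷ w ∷ r)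

  inducedPath⇒unique : InducedPath l → Unique l
  inducedPath⇒unique [-] = [] ∷ []
  inducedPath⇒unique (cons ≢s _ _ ip) = ≢s ∷ inducedPath⇒unique ip

  inducedPath-lookup : InducedPath l →
    ∀ i j → Adj G (lookup l i) (lookup l j) ⇔ Consecutive (toℕ i) (toℕ j)
  inducedPath-lookup {l = _ ∷ _} _ zero zero =
    mk⇔ (⊥-elim ∘ adj-irrefl) λ { (inj₁ ()) ; (inj₂ ()) }
  inducedPath-lookup (cons _ a ¬as _) zero (suc j) =
    ⇔.trans (onlyHead-lookup a ¬as j)
      (mk⇔ (inj₁ ∘ cong suc ∘ sym) λ { (inj₁ e) → sym (suc-injective e) })
  inducedPath-lookup ip@(cons _ _ _ _) (suc i) zero =
    ⇔.trans adj-comm (⇔.trans (inducedPath-lookup ip zero (suc i)) (mk⇔ Sum.swap Sum.swap))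
  inducedPath-lookup (cons _ _ _ ip) (suc i) (suc j) =
    ⇔.trans (inducedPath-lookup ip i j) (⇔.sym consecutive-suc)

  Hit : Fin n → Fin n → Set
  Hit u w = u ≡ w ⊎ Adj G u w

  hit? : ∀ u → Decidable (Hit u)
  hit? u w with u ≟ w | adj? u w
  ... | yes e | _ = yes (inj₁ e)
  ... | no _ | yes a = yes (inj₂ a)
  ... | no ≢ | no ¬a = no λ { (inj₁ e) → ≢ e ; (inj₂ a) → ¬a a }

  -- u is joined to the last vertex of l that equals or neighbours it.
  attach : ∀ l → InducedPath l → All P l → Any (Hit u) l →
    ∃[ q ] (InducedPath (u ∷ q) × last (u ∷ q) ≡ last l × All P q)
  attach {u = u} (w ∷ r) ip ps h with any? (hit? u) r
  attach (w ∷ []) _ _ _ | yes ()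
  attach (w ∷ w′ ∷ r) (cons _ _ _ ip) (_ ∷ ps) _ | yes h = attach (w′ ∷ r) ip ps h
  attach (w ∷ r) _ _ (there h) | no ¬h = ⊥-elim (¬h h)
  attach (w ∷ r) ip (_ ∷ ps) (here (inj₁ refl)) | no _ = r , ip , refl , ps
  attach (w ∷ r) ip ps (here (inj₂ a)) | no ¬h =
    w ∷ r ,
    cons ((λ { refl → adj-irrefl a }) ∷ All.map (_∘ inj₁) ¬hs) a (All.map (_∘ inj₂) ¬hs) ip ,
    refl , ps
    where ¬hs = ¬Any⇒All¬ r ¬h

  connIn⇒inducedPath : ConnIn G P u w →
    ∃[ p ] (InducedPath (u ∷ p) × last (u ∷ p) ≡ just w × All P (u ∷ p))
  connIn⇒inducedPath (here p) = [] , [-] , refl , p ∷ []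
  connIn⇒inducedPath (step p a c) with connIn⇒inducedPath c
  ... | q , ip , lq , ps with attach (_ ∷ q) ip ps (here (inj₂ a))
  ...   | q′ , ip′ , lq′ , ps′ = q′ , ip′ , trans lq′ lq , p ∷ ps′

  inducedPathFromNeighbour : (∀ {e} → P e → e ≢ b) → ConnIn G P u w → Adj G b u →
    ∃[ l ] (InducedPath (b ∷ l) × last l ≡ just w × All P l)
  inducedPathFromNeighbour P∌b c a with connIn⇒inducedPath c
  ... | q , ip , lq , ps with attach (_ ∷ q) ip ps (here (inj₂ a))
  ...   | [] , _ , lq′ , _ =
    ⊥-elim (P∌b (connIn-target c) (sym (just-injective (trans lq′ lq))))
  ...   | l@(_ ∷ _) , ip′ , lq′ , ps′ = l , ip′ , trans lq′ lq , ps′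

  inducedPathToNeighbour : ConnIn G P u w → Adj G b w →
    ∃[ p ] (InducedPath (u ∷ p) × OnlyLast (Adj G b) (u ∷ p) × All P (u ∷ p))
  inducedPathToNeighbour {b = b} c a with truncateAtFirst (adj? b) c a
  ... | _ , a′ , c′ with connIn⇒inducedPath c′
  ...   | p , ip , lp , ps =
    p , ip , onlyLast-unique (inducedPath⇒unique ip) lp a′ (All.map proj₂ ps) ,
    All.map proj₁ ps

  Separated : List (Fin n) → List (Fin n) → Set
  Separated xs ys = All (λ x → All (λ y → x ≢ y × ¬ Adj G x y) ys) xs

  inducedPath-++ : InducedPath xs → OnlyLast (Adj G b) xs → All (_≢ b) xs →
    Separated xs ys → InducedPath (b ∷ ys) → InducedPath (xs ++ b ∷ ys)
  inducedPath-++ [-] [ a ] (≢b ∷ []) (sep ∷ []) ip =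
    cons (≢b ∷ All.map proj₁ sep) (adj-sym a) (All.map proj₂ sep) ip
  inducedPath-++ (cons ≢s a ¬as ip′) (¬a ∷ ol) (≢b ∷ ≢bs) (sep ∷ seps) ip =
    cons (++⁺ ≢s (≢b ∷ All.map proj₁ sep)) a (++⁺ ¬as ((¬a ∘ adj-sym) ∷ All.map proj₂ sep))
      (inducedPath-++ ip′ ol ≢bs seps ip)

  cycAdj-comm : ∀ {k} {i j : Fin k} → CycAdj G k i j → CycAdj G k j i
  cycAdj-comm (inj₁ e) = inj₂ (inj₁ e)
  cycAdj-comm (inj₂ (inj₁ e)) = inj₁ e
  cycAdj-comm (inj₂ (inj₂ (inj₁ p))) = inj₂ (inj₂ (inj₂ p))
  cycAdj-comm (inj₂ (inj₂ (inj₂ p))) = inj₂ (inj₂ (inj₁ p))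

  ¬cycAdj-zero-zero : ∀ {k} → ¬ CycAdj G (suc (suc k)) zero zero
  ¬cycAdj-zero-zero (inj₂ (inj₂ (inj₁ (_ , ()))))
  ¬cycAdj-zero-zero (inj₂ (inj₂ (inj₂ (_ , ()))))

  cycAdj-zero-suc : ∀ {k} (j : Fin k) →
    CycAdj G (suc k) zero (suc j) ⇔ (toℕ j ≡ 0 ⊎ suc (toℕ j) ≡ k)
  cycAdj-zero-suc j = mk⇔
    (λ { (inj₁ e) → inj₁ (sym (suc-injective e))
       ; (inj₂ (inj₂ (inj₁ (_ , e)))) → inj₂ (suc-injective e) })
    (λ { (inj₁ e) → inj₁ (cong suc (sym e))
       ; (inj₂ e) → inj₂ (inj₂ (inj₁ (refl , cong suc e))) })

  cycAdj-suc-suc : ∀ {k} (i j : Fin k) →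
    CycAdj G (suc k) (suc i) (suc j) ⇔ Consecutive (toℕ i) (toℕ j)
  cycAdj-suc-suc i j = mk⇔
    (λ { (inj₁ e) → inj₁ (suc-injective e)
       ; (inj₂ (inj₁ e)) → inj₂ (suc-injective e)
       ; (inj₂ (inj₂ (inj₁ (() , _))))
       ; (inj₂ (inj₂ (inj₂ (() , _)))) })
    (λ { (inj₁ e) → inj₁ (cong suc e) ; (inj₂ e) → inj₂ (inj₁ (cong suc e)) })

  closeCycle : InducedPath (u ∷ r) → Adj G v u → OnlyLast (Adj G v) r →
    All (v ≢_) (u ∷ r) → 2 ≤ length r → ChordlessCycle G (v ∷ u ∷ r)
  closeCycle {u = u} {r = r@(_ ∷ _ ∷ _)} {v = v} ip vu ol v∉ (s≤s (s≤s z≤n)) =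
    s≤s (s≤s (s≤s (s≤s z≤n))) , v∉ ∷ inducedPath⇒unique ip , adjacency
    where
    adjacency : ∀ i j → Adj G (lookup (v ∷ u ∷ r) i) (lookup (v ∷ u ∷ r) j) ⇔
                         CycAdj G (length (v ∷ u ∷ r)) i j
    adjacency zero zero = mk⇔ (⊥-elim ∘ adj-irrefl) (⊥-elim ∘ ¬cycAdj-zero-zero)
    adjacency zero (suc j) = ⇔.trans (endsOnly-lookup vu ol j) (⇔.sym (cycAdj-zero-suc j))
    adjacency (suc i) zero =
      ⇔.trans adj-comm (⇔.trans (adjacency zero (suc i)) (mk⇔ cycAdj-comm cycAdj-comm))
    adjacency (suc i) (suc j) =
      ⇔.trans (inducedPath-lookup ip i j) (⇔.sym (cycAdj-suc-suc i j))

module Interface {n : ℕ} (G : Graph n) (v : Fin n) (B I : Subset n)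
  (v∉B : v ∉ B) (chordal : ChordalMinus G B) (independent : Independent G I)
  (I-attached : ∀ z → z ∈ I → Adj G v z × z ∉ B) where

  open Setting G v B I

  private
    variable
      b e u z z′ : Fin n

  inH-adj⇒∈I : InH u → Adj G v u → u ∈ I
  inH-adj⇒∈I {u} (_ , u∉B , ¬X) a with u ∈? I
  ... | yes u∈I = u∈I
  ... | no u∉I = ⊥-elim (¬X (a , u∉B , u∉I))

  comp-inH : Comp z u → InH u
  comp-inH = connIn-target G

  comp-≢v : Comp z u → v ≢ u
  comp-≢v c = ≢-sym (proj₁ (comp-inH c))

  comp-∉B : Comp z u → u ∉ B
  comp-∉B c = proj₁ (proj₂ (comp-inH c))

  comp-≢ : b ∈ B → Comp z u → u ≢ b
  comp-≢ b∈B c refl = comp-∉B c b∈B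

  comp-walkFrom : Comp z u → ConnIn G (Comp z) z u
  comp-walkFrom = connIn-reach G

  comp-walkTo : Comp z u → ConnIn G (Comp z) u z
  comp-walkTo c = connIn-map G (connIn-trans G c) (connIn-reach G (connIn-sym G c))

  comp-separated : ¬ Comp z z′ → Comp z e → Comp z′ u → e ≢ u × ¬ Adj G e u
  comp-separated ¬c ce cu =
    (λ { refl → ¬c (connIn-trans G ce (connIn-sym G cu)) }) ,
    (λ a → ¬c (connIn-trans G (connIn-snoc G ce a (comp-inH cu)) (connIn-sym G cu)))

  I-≢v : z ∈ I → v ≢ z
  I-≢v {z} z∈I refl = adj-irrefl G (proj₁ (I-attached z z∈I))

  B-≢v : b ∈ B → v ≢ b
  B-≢v b∈B refl = v∉B b∈B

  comp-adj⇒≡ : z ∈ I → Comp z e → Adj G v e → e ≡ z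
  comp-adj⇒≡ {z} {e} z∈I c a with e ≟ z
  ... | yes e≡z = e≡z
  ... | no e≢z
    with truncateAtFirst G (λ u → u ∈? I ×-dec ¬? (u ≟ z)) (comp-walkFrom c)
           (inH-adj⇒∈I (comp-inH c) a , e≢z)
  ... | t , (t∈I , t≢z) , c′ with connIn⇒inducedPath G c′
  ... | [] , _ , refl , _ = ⊥-elim (t≢z refl)
  ... | _ ∷ [] , cons _ zt _ _ , refl , _ = ⊥-elim (independent z t z∈I t∈I zt)
  ... | p@(_ ∷ _ ∷ _) , ip@(cons z∉p _ _ _) , lp , (_ ∷ ps) =
    ⊥-elim (chordal (v ∷ z ∷ p)
      (closeCycle G ip (proj₁ (I-attached z z∈I)) vOnlyAtEnd v∉ (s≤s (s≤s z≤n)))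
      (v∉B ∷ proj₂ (I-attached z z∈I) ∷ All.map (comp-∉B ∘ proj₁) ps))
    where
    vOnlyAtEnd : OnlyLast (Adj G v) p
    vOnlyAtEnd = onlyLast-unique (AllPairs.tail (inducedPath⇒unique G ip)) lp
      (proj₁ (I-attached t t∈I))
      (All.zipWith (λ (z≢ , c , f) a → f (inH-adj⇒∈I (comp-inH c) a , ≢-sym z≢))
        (z∉p , ps))
    v∉ : All (v ≢_) (z ∷ p)
    v∉ = I-≢v z∈I ∷ All.map (comp-≢v ∘ proj₁) ps

  comp-¬adj : z ∈ I → All (z ≢_) l → All (Comp z) l → All (¬_ ∘ Adj G v) l
  comp-¬adj z∈I z∉l cs = All-¬-elsewhere z∉l (All.map (comp-adj⇒≡ z∈I) cs)

  comp-onlyLast : z ∈ I → Unique l → last l ≡ just z → All (Comp z) l →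
    OnlyLast (Adj G v) l
  comp-onlyLast {z} z∈I u lz cs =
    onlyLast-unique u lz (proj₁ (I-attached z z∈I)) (All.map (comp-adj⇒≡ z∈I) cs)

  hatEdgeC⇒chordlessCycle : ∀ b z → b ∈ B → Adj G v b → z ∈ I → HatEdgeC b z →
    ∃[ P ] (last P ≡ just z × All (Comp z) P × ChordlessCycle G (v ∷ b ∷ P))
  hatEdgeC⇒chordlessCycle b z b∈B vb z∈I ((u , c , bu) , ¬zb)
    with inducedPathFromNeighbour G (comp-≢ b∈B) (comp-walkTo c) bu
  ... | [] , _ , () , _
  ... | _ ∷ [] , cons _ bz _ _ , refl , _ = ⊥-elim (¬zb (adj-sym G bz))
  ... | P@(_ ∷ _ ∷ _) , ip@(cons _ _ _ ipP) , lP , cs =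
    P , lP , cs ,
    closeCycle G ip vb (comp-onlyLast z∈I (inducedPath⇒unique G ipP) lP cs)
      (B-≢v b∈B ∷ All.map comp-≢v cs) (s≤s (s≤s z≤n))

  hatEdgeF⇒chordlessCycle : ∀ b z z′ → b ∈ B → ¬ Adj G v b → z ∈ I → z′ ∈ I →
    ¬ Comp z z′ → HatEdgeF b z → HatEdgeF b z′ →
    ∃[ P ] ∃[ Q ] (head P ≡ just z × last Q ≡ just z′ × All (Comp z) P × All (Comp z′) Q
      × ChordlessCycle G (v ∷ P ++ b ∷ Q))
  hatEdgeF⇒chordlessCycle b z z′ b∈B ¬vb z∈I z′∈I ¬c (u , c , bu) (u′ , c′ , bu′)
    with inducedPathToNeighbour G (comp-walkFrom c) bu
       | inducedPathFromNeighbour G (comp-≢ b∈B) (comp-walkTo c′) bu′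
  ... | _ | [] , _ , () , _
  ... | p , ipP , olP , csP | Q@(_ ∷ _) , ipQ@(cons _ _ _ ipQ′) , lQ , csQ =
    z ∷ p , Q , refl , lQ , csP , csQ ,
    closeCycle G
      (inducedPath-++ G ipP olP (All.map (comp-≢ b∈B) csP)
        (All.map (λ ce → All.map (comp-separated ¬c ce) csQ) csP) ipQ)
      (proj₁ (I-attached z z∈I))
      (onlyLast-++
        (comp-¬adj z∈I (AllPairs.head (inducedPath⇒unique G ipP)) (All.tail csP))
        (¬vb ∷ comp-onlyLast z′∈I (inducedPath⇒unique G ipQ′) lQ csQ))
      (++⁺ (All.map comp-≢v csP) (B-≢v b∈B ∷ All.map comp-≢v csQ))
      (≤-trans (s≤s (s≤s z≤n)) (length-++-≤ʳ (b ∷ Q) {p}))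

lemma3p9 : {n : ℕ} (G : Graph n) (EI EM : Fin n → Fin n → Set)
    → EdgeSubset G EI → EdgeSubset G EM
    → (v : Fin n) (B I : Subset n)
    → v ∉ B
    → ChordalMinus G B
    → Independent G I
    → (∀ z → z ∈ I → InNR G EI EM v z × z ∉ B)
    → let open Setting G v B I in
      (∀ (b z : Fin n) → b ∈ B → Adj G v b → z ∈ I
        → HatEdgeC b z
        → ∃[ P ] (last P ≡ just z × All (Comp z) P × ChordlessCycle G (v ∷ b ∷ P)))
      × (∀ (b z z′ : Fin n) → b ∈ B → ¬ Adj G v b → z ∈ I → z′ ∈ I
        → ¬ Comp z z′
        → HatEdgeF b z → HatEdgeF b z′
        → ∃[ P ] ∃[ Q ] (head P ≡ just z × last Q ≡ just z′
            × All (Comp z) P × All (Comp z′) Q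
            × ChordlessCycle G (v ∷ P ++ b ∷ Q)))
lemma3p9 G _ _ _ _ v B I v∉B chordal independent I⊆NR =
  hatEdgeC⇒chordlessCycle , hatEdgeF⇒chordlessCycle
  where
  open Interface G v B I v∉B chordal independent
    (λ z z∈I → proj₁ (proj₁ (I⊆NR z z∈I)) , proj₂ (I⊆NR z z∈I))
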